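{- Let $\mathbb K$ be a field of characteristic zero, $\mathfrak d$ a delta operator on $\mathbb K[x]$, $\mathcal Z=(z_i)_{i\ge0}$ a sequence in $\mathbb K$ and $\xi\in\mathbb K$. Let $(h_n(x))_{n\ge0}$ be the generalized Gončarov basis associated with $(\mathfrak d,\mathcal W)$, where $\mathcal W=(w_i)_{i\ge0}$, $w_i=z_i+i\xi$. Then $(h_n(x))_{n\ge0}$ is also the generalized Gončarov basis associated with the pair $(E_\xi\mathfrak d,\mathcal Z)$.
   Context: $E_a$ denotes the shift operator $f(x)\mapsto f(x+a)$ on $\mathbb K[x]$. A shift-invariant operator is a linear operator commuting with all $E_a$; a delta operator is a shift-invariant operator $\mathfrak d$ with $\mathfrak d(x)$ a nonzero constant ($E_\xi\mathfrak d$ is again a delta operator). For a delta operator $\mathfrak d$ and a sequence $\mathcal Z=(z_i)_{i\ge0}$ in $\mathbb K$, the generalized Gončarov basis associated with $(\mathfrak d,\mathcal Z)$ is the unique sequence of polynomials $(t_n)_{n\ge0}$ with $\deg t_n=n$ and $\varepsilon_{z_i}(\mathfrak d^i t_n)=n!\,\delta_{i,n}$ for all $i,n$ ($\varepsilon_z$ evaluation at $z$, $\mathfrak d^i$ the $i$-th iterate). -}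

module Defs where

open import Level using (Level; _⊔_) renaming (suc to lsuc)
open import Algebra.Bundles using (CommutativeRing)
open import Data.Nat using (ℕ; zero; suc; _<_; _≟_)
open import Data.Nat.Base using (_!)
open import Data.List using (List; []; _∷_; map)
open import Data.Product using (Σ; _×_)
open import Relation.Nullary using (¬_; yes; no)
open import Relation.Binary.PropositionalEquality using (_≡_)

record Field (c ℓ : Level) : Set (lsuc (c ⊔ ℓ)) where
  field
    commRing : CommutativeRing c ℓ
  open CommutativeRing commRing public hiding (ring)
  field
    0≉1     : ¬ (0# ≈ 1#)
    inverse : ∀ x → ¬ (x ≈ 0#) → Σ Carrier (λ y → x * y ≈ 1#)

module FieldDefs {c ℓ : Level} (F : Field c ℓ) where
  open Field F

  fromℕ : ℕ → Carrier
  fromℕ zero    = 0#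
  fromℕ (suc n) = 1# + fromℕ n

  CharZero : Set ℓ
  CharZero = ∀ n → ¬ (fromℕ (suc n) ≈ 0#)

  -- polynomials in K[x] as coefficient lists (constant term first);
  -- trailing zeros are allowed, equality is coefficientwise.
  Poly : Set c
  Poly = List Carrier

  coeff : Poly → ℕ → Carrier
  coeff []      _       = 0#
  coeff (a ∷ p) zero    = a
  coeff (a ∷ p) (suc k) = coeff p k

  infix 4 _≋_
  _≋_ : Poly → Poly → Set ℓ
  p ≋ q = ∀ k → coeff p k ≈ coeff q k

  infixl 6 _⊕_
  _⊕_ : Poly → Poly → Poly
  []      ⊕ q       = q
  (a ∷ p) ⊕ []      = a ∷ p
  (a ∷ p) ⊕ (b ∷ q) = (a + b) ∷ (p ⊕ q)

  scale : Carrier → Poly → Poly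
  scale a p = map (a *_) p

  infixl 7 _⊗_
  _⊗_ : Poly → Poly → Poly
  []      ⊗ q = []
  (a ∷ p) ⊗ q = scale a q ⊕ (0# ∷ (p ⊗ q))

  const : Carrier → Poly
  const a = a ∷ []

  X : Poly
  X = 0# ∷ 1# ∷ []

  -- shift operator E_a : f(x) ↦ f(x + a)   (Horner scheme)
  E : Carrier → Poly → Poly
  E a []      = []
  E a (b ∷ p) = const b ⊕ ((a ∷ 1# ∷ []) ⊗ E a p)

  ev : Carrier → Poly → Carrier
  ev z []      = 0#
  ev z (a ∷ p) = a + z * ev z p

  HasDegree : Poly → ℕ → Set ℓ
  HasDegree p n = ¬ (coeff p n ≈ 0#) × (∀ k → n < k → coeff p k ≈ 0#)

  IsLinear : (Poly → Poly) → Set (c ⊔ ℓ)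
  IsLinear T = (∀ p q → p ≋ q → T p ≋ T q)
             × (∀ p q → T (p ⊕ q) ≋ T p ⊕ T q)
             × (∀ a p → T (scale a p) ≋ scale a (T p))

  IsShiftInvariant : (Poly → Poly) → Set (c ⊔ ℓ)
  IsShiftInvariant T = IsLinear T × (∀ a p → T (E a p) ≋ E a (T p))

  IsDelta : (Poly → Poly) → Set (c ⊔ ℓ)
  IsDelta T = IsShiftInvariant T
            × Σ Carrier (λ b → ¬ (b ≈ 0#) × (T X ≋ const b))

  iter : (Poly → Poly) → ℕ → Poly → Poly
  iter T zero    p = p
  iter T (suc i) p = T (iter T i p)

  factδ : ℕ → ℕ → Carrier
  factδ i n with i ≟ n
  ... | yes _ = fromℕ (n !)
  ... | no  _ = 0#

  -- (t_n) is the generalized Gončarov basis associated with (T, z):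
  -- deg t_n = n and ε_{z_i}(T^i t_n) = n! δ_{i,n} for all i, n.
  -- (Such a sequence is unique, so this predicate characterizes "the" basis.)
  IsGoncarovBasis : (Poly → Poly) → (ℕ → Carrier) → (ℕ → Poly) → Set ℓ
  IsGoncarovBasis T z t = (∀ n → HasDegree (t n) n)
                        × (∀ i n → ev (z i) (iter T i (t n)) ≈ factδ i n)

-- Since 𝔡 commutes with E_ξ, (E_ξ 𝔡)^i = E_ξ^i 𝔡^i, and ε_w ∘ E_ξ = ε_{w+ξ}; hence
-- ε_{z_i}((E_ξ 𝔡)^i p) = ε_{z_i + iξ}(𝔡^i p) = ε_{w_i}(𝔡^i p). The interpolation
-- conditions defining the two bases therefore coincide, and the degrees are the same.
module Submission where

open import Defs
open import Level using (Level)
open import Data.Nat using (ℕ; zero; suc)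
open import Data.List using ([]; _∷_)
open import Data.Product using (_,_; proj₁)
open import Function using (_∘_)
open import Relation.Binary.PropositionalEquality as ≡ using (_≡_)
import Algebra.Properties.CommutativeSemigroup as CommSemigroupProperties
import Relation.Binary.Reasoning.Setoid as SetoidReasoning

module GoncarovShift {c ℓ : Level} (F : Field c ℓ) where
  open Field F
  open FieldDefs F
  open SetoidReasoning setoid
  module +-Props = CommSemigroupProperties +-commutativeSemigroup
  module *-Props = CommSemigroupProperties *-commutativeSemigroup

  ev-≋[] : ∀ z p → p ≋ [] → ev z p ≈ 0#
  ev-≋[] z []      p≋0 = refl
  ev-≋[] z (a ∷ p) p≋0 = begin
    a + z * ev z p ≈⟨ +-cong (p≋0 0) (*-congˡ (ev-≋[] z p (p≋0 ∘ suc))) ⟩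
    0# + z * 0#    ≈⟨ +-identityˡ _ ⟩
    z * 0#         ≈⟨ zeroʳ z ⟩
    0#             ∎

  ev-congˡ : ∀ z p q → p ≋ q → ev z p ≈ ev z q
  ev-congˡ z []      q       p≋q = sym (ev-≋[] z q (sym ∘ p≋q))
  ev-congˡ z (a ∷ p) []      p≋q = ev-≋[] z (a ∷ p) p≋q
  ev-congˡ z (a ∷ p) (b ∷ q) p≋q =
    +-cong (p≋q 0) (*-congˡ (ev-congˡ z p q (p≋q ∘ suc)))

  ev-congʳ : ∀ {z w} p → z ≈ w → ev z p ≈ ev w p
  ev-congʳ []      z≈w = refl
  ev-congʳ (a ∷ p) z≈w = +-congˡ (*-cong z≈w (ev-congʳ p z≈w))

  ev-⊕ : ∀ z p q → ev z (p ⊕ q) ≈ ev z p + ev z q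
  ev-⊕ z []      q       = sym (+-identityˡ _)
  ev-⊕ z (a ∷ p) []      = sym (+-identityʳ _)
  ev-⊕ z (a ∷ p) (b ∷ q) = begin
    (a + b) + z * ev z (p ⊕ q)          ≈⟨ +-congˡ (*-congˡ (ev-⊕ z p q)) ⟩
    (a + b) + z * (ev z p + ev z q)     ≈⟨ +-congˡ (distribˡ z _ _) ⟩
    (a + b) + (z * ev z p + z * ev z q) ≈⟨ +-Props.interchange a b _ _ ⟩
    (a + z * ev z p) + (b + z * ev z q) ∎

  ev-scale : ∀ z a p → ev z (scale a p) ≈ a * ev z p
  ev-scale z a []      = sym (zeroʳ a)
  ev-scale z a (b ∷ p) = begin
    a * b + z * ev z (scale a p) ≈⟨ +-congˡ (*-congˡ (ev-scale z a p)) ⟩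
    a * b + z * (a * ev z p)     ≈⟨ +-congˡ (*-Props.x∙yz≈y∙xz z a _) ⟩
    a * b + a * (z * ev z p)     ≈⟨ distribˡ a _ _ ⟨
    a * (b + z * ev z p)         ∎

  ev-⊗ : ∀ z p q → ev z (p ⊗ q) ≈ ev z p * ev z q
  ev-⊗ z []      q = sym (zeroˡ _)
  ev-⊗ z (a ∷ p) q = begin
    ev z (scale a q ⊕ (0# ∷ (p ⊗ q)))           ≈⟨ ev-⊕ z (scale a q) _ ⟩
    ev z (scale a q) + (0# + z * ev z (p ⊗ q))  ≈⟨ +-cong (ev-scale z a q) (+-identityˡ _) ⟩
    a * ev z q + z * ev z (p ⊗ q)               ≈⟨ +-congˡ (*-congˡ (ev-⊗ z p q)) ⟩
    a * ev z q + z * (ev z p * ev z q)          ≈⟨ +-congˡ (*-assoc z _ _) ⟨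
    a * ev z q + (z * ev z p) * ev z q          ≈⟨ distribʳ _ a _ ⟨
    (a + z * ev z p) * ev z q                   ∎

  ev-X+const : ∀ z a → ev z (a ∷ 1# ∷ []) ≈ z + a
  ev-X+const z a = begin
    a + z * (1# + z * 0#) ≈⟨ +-congˡ (*-congˡ (+-congˡ (zeroʳ z))) ⟩
    a + z * (1# + 0#)     ≈⟨ +-congˡ (*-congˡ (+-identityʳ 1#)) ⟩
    a + z * 1#            ≈⟨ +-congˡ (*-identityʳ z) ⟩
    a + z                 ≈⟨ +-comm a z ⟩
    z + a                 ∎

  ev-E : ∀ z a p → ev z (E a p) ≈ ev (z + a) p
  ev-E z a []      = refl
  ev-E z a (b ∷ p) = begin
    ev z (const b ⊕ ((a ∷ 1# ∷ []) ⊗ E a p))           ≈⟨ ev-⊕ z (const b) ((a ∷ 1# ∷ []) ⊗ E a p) ⟩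
    (b + z * 0#) + ev z ((a ∷ 1# ∷ []) ⊗ E a p)        ≈⟨ +-cong (trans (+-congˡ (zeroʳ z)) (+-identityʳ b))
                                                                 (ev-⊗ z (a ∷ 1# ∷ []) (E a p)) ⟩
    b + ev z (a ∷ 1# ∷ []) * ev z (E a p)              ≈⟨ +-congˡ (*-cong (ev-X+const z a) (ev-E z a p)) ⟩
    b + (z + a) * ev (z + a) p                         ∎

  +-fromℕ-*-suc : ∀ w i ξ → (w + fromℕ i * ξ) + ξ ≈ w + fromℕ (suc i) * ξ
  +-fromℕ-*-suc w i ξ = begin
    (w + fromℕ i * ξ) + ξ      ≈⟨ +-assoc w _ ξ ⟩
    w + (fromℕ i * ξ + ξ)      ≈⟨ +-congˡ (+-comm _ ξ) ⟩
    w + (ξ + fromℕ i * ξ)      ≈⟨ +-congˡ (+-congʳ (*-identityˡ ξ)) ⟨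
    w + (1# * ξ + fromℕ i * ξ) ≈⟨ +-congˡ (distribʳ ξ 1# _) ⟨
    w + (1# + fromℕ i) * ξ     ∎

  iter-suc′ : ∀ T i p → iter T (suc i) p ≡ iter T i (T p)
  iter-suc′ T zero    p = ≡.refl
  iter-suc′ T (suc i) p = ≡.cong T (iter-suc′ T i p)

  iter-E-comm : ∀ {T} → (∀ p q → p ≋ q → T p ≋ T q) →
                ∀ {ξ} → (∀ p → T (E ξ p) ≋ E ξ (T p)) →
                ∀ i p → iter T i (E ξ p) ≋ E ξ (iter T i p)
  iter-E-comm T-cong T-E-comm zero    p k = refl
  iter-E-comm T-cong T-E-comm (suc i) p k =
    trans (T-cong _ _ (iter-E-comm T-cong T-E-comm i p) k) (T-E-comm (iter _ i p) k)

  ev-iter-E∘ : ∀ {T} → (∀ p q → p ≋ q → T p ≋ T q) →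
               ∀ {ξ} → (∀ p → T (E ξ p) ≋ E ξ (T p)) →
               ∀ i p w → ev w (iter (E ξ ∘ T) i p) ≈ ev (w + fromℕ i * ξ) (iter T i p)
  ev-iter-E∘ T-cong {ξ} T-E-comm zero p w =
    ev-congʳ p (sym (trans (+-congˡ (zeroˡ ξ)) (+-identityʳ w)))
  ev-iter-E∘ {T} T-cong {ξ} T-E-comm (suc i) p w = begin
    ev w (iter (E ξ ∘ T) (suc i) p)     ≡⟨ ≡.cong (ev w) (iter-suc′ (E ξ ∘ T) i p) ⟩
    ev w (iter (E ξ ∘ T) i (E ξ (T p))) ≈⟨ ev-iter-E∘ T-cong T-E-comm i (E ξ (T p)) w ⟩
    ev w′ (iter T i (E ξ (T p)))        ≈⟨ ev-congˡ w′ (iter T i (E ξ (T p))) (E ξ (iter T i (T p)))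
                                                      (iter-E-comm T-cong T-E-comm i (T p)) ⟩
    ev w′ (E ξ (iter T i (T p)))        ≈⟨ ev-E w′ ξ (iter T i (T p)) ⟩
    ev (w′ + ξ) (iter T i (T p))        ≈⟨ ev-congʳ (iter T i (T p)) (+-fromℕ-*-suc w i ξ) ⟩
    ev w″ (iter T i (T p))              ≡⟨ ≡.cong (ev w″) (iter-suc′ T i p) ⟨
    ev w″ (iter T (suc i) p)            ∎
    where w′ = w + fromℕ i * ξ
          w″ = w + fromℕ (suc i) * ξ

proposition3p6 : ∀ {c ℓ : Level} (F : Field c ℓ) →
    let open Field F
        open FieldDefs F
    in CharZero →
       (d : Poly → Poly) → IsDelta d →
       (z : ℕ → Carrier) → (ξ : Carrier) → (h : ℕ → Poly) →
       IsGoncarovBasis d (λ i → z i + fromℕ i * ξ) h →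
       IsGoncarovBasis (E ξ ∘ d) z h
proposition3p6 F _ d ((d-linear , d-E-comm) , _) z ξ h (h-degree , h-interpolates) =
  h-degree , λ i n → trans (ev-iter-E∘ (proj₁ d-linear) (d-E-comm ξ) i (h n) (z i))
                           (h-interpolates i n)
  where open Field F
        open GoncarovShift F
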